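{- Let $n\ge1$ be a non-Haj\'{o}s number, i.e. there exists a factorization of size $n$ which is not a Haj\'{o}s factorization. Then $n$ is not a cbc Haj\'{o}s number, i.e. there exists a compatible set of $n$-cbc which is not of Haj\'{o}s.
   Context: Fix an alphabet $\mathcal A$ containing distinct letters $a,b$. A code is a set $X\subseteq\mathcal A^*$ such that $x_1\cdots x_t=y_1\cdots y_{t'}$ with $x_i,y_i\in X$ implies $t=t'$ and $x_i=y_i$ for all $i$. Write $[n]=\{0,\dots,n-1\}$, $u\bmod n$ for the remainder in $[n]$, $U\bmod m=\{u\bmod m:u\in U\}$. A pair $(P,Q)$ of sets of integers is a factorization of size $n$ if every $k\in[n]$ can be written in exactly one way as $k\equiv p+q\pmod n$ with $p\in P,q\in Q$. A set $U$ is $m$-periodic in $\mathbb Z_n$ ($m\not\equiv0\pmod n$) if $\{(m+u)\bmod n:u\in U\}=\{u\bmod n:u\in U\}$. A factorization $(P,Q)$ of size $n$ is Haj\'{o}s if $n=1$, or for some $m$ with $0<m<n$, $m\mid n$, either $P$ is $m$-periodic in $\mathbb Z_n$ and $(P\bmod m,Q)$ is a Haj\'{o}s factorization of size $m$, or $Q$ is $m$-periodic in $\mathbb Z_n$ and $(P,Q\bmod m)$ is a Haj\'{o}s factorization of size $m$. An $n$-cbc is a set $X\subseteq a^{[n]}ba^{[n]}$ with $|X|=n$ such that $\{a^n\}\cup X$ is a code. For $n$-cbc $X,Y$ and $r\in[n]$, $X\circ_rY=\{a^iba^\ell: a^iba^j\in X, a^kba^\ell\in Y, (j+k)\bmod n=r\}$;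 a set $\mathcal E$ of $n$-cbc is compatible if every composition $X_1\circ_{r_1}\cdots\circ_{r_k}X_{k+1}$ ($X_i\in\mathcal E$, $r_i\in[n]$) is an $n$-cbc. Dual: $\overline X=\{a^jba^i:a^iba^j\in X\}$, $\overline{\mathcal E}=\{\overline X:X\in\mathcal E\}$. For an $m$-element set $X=\{a^{i_1}ba^{j_1},\dots,a^{i_m}ba^{j_m}\}\subseteq a^{[m]}ba^{[m]}$ and $t\ge1$, $H_t(X)$ is the set of all sets $\bigcup_{\ell=1}^{m}\{a^{i_\ell+k_{\ell,s}m}ba^{j_\ell+sm}:s=0,\dots,t-1\}$ with $k_{\ell,s}\in[t]$ arbitrary. A set $\mathcal E$ of $n$-cbc is of Haj\'{o}s if $\mathcal E=\{\{b\}\}$ ($n=1$) or there exist $k\ge1$ and $t_1,\dots,t_k>1$ such that either for every $Y\in\mathcal E$, or for every $Y\in\overline{\mathcal E}$, there are sets $Y_1,\dots,Y_{k-1}$ with ($Y_0=\{b\}$) $Y\in H_{t_k}(Y_{k-1})$ and $\overline{Y_i}\in H_{t_i}(Y_{i-1})$ for $1\le i\le k-1$. An integer $n$ is a cbc Haj\'{o}s number if every compatible set of $n$-cbc is of Haj\'{o}s. -}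

module Defs where

open import Level using (0ℓ)
open import Data.Nat as ℕ using (ℕ; zero; suc; _<_; NonZero)
open import Data.Nat.Divisibility using (_∣_)
open import Data.Integer as ℤ using (ℤ; +_; _%ℕ_)
open import Data.Product using (Σ; ∃; _×_; _,_)
open import Data.Sum using (_⊎_)
open import Data.Empty using (⊥)
open import Data.List using (List; []; _∷_; length; replicate; concat; foldl; _++_)
open import Data.List.Relation.Unary.All using (All)
open import Data.List.Relation.Unary.Unique.Propositional using (Unique)
open import Data.List.Membership.Propositional using (_∈_)
open import Relation.Unary using (Pred)
open import Relation.Binary.PropositionalEquality using (_≡_)
open import Function.Bundles using (_⇔_)

ZSet : Set₁
ZSet = Pred ℤ 0ℓ

Factorization : (n : ℕ) .{{_ : NonZero n}} → ZSet → ZSet → Set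
Factorization n P Q =
  ∀ k → k < n →
    Σ ℤ λ p → Σ ℤ λ q → P p × Q q × ((p ℤ.+ q) %ℕ n ≡ k) ×
      (∀ p' q' → P p' → Q q' → (p' ℤ.+ q') %ℕ n ≡ k → (p' ≡ p × q' ≡ q))

Periodic : (n : ℕ) .{{_ : NonZero n}} → ℕ → ZSet → Set
Periodic n m U =
  ∀ r → (∃ λ u → U u × ((+ m ℤ.+ u) %ℕ n ≡ r)) ⇔ (∃ λ u → U u × (u %ℕ n ≡ r))

ModSet : ZSet → (m : ℕ) .{{_ : NonZero m}} → ZSet
ModSet U m z = ∃ λ u → U u × (z ≡ + (u %ℕ m))

data IsHajos : ℕ → ZSet → ZSet → Set₁ where
  base  : ∀ {P Q} → Factorization 1 P Q → IsHajos 1 P Q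
  stepP : ∀ {n m P Q} .{{_ : NonZero n}} .{{_ : NonZero m}} →
          Factorization n P Q → m < n → m ∣ n →
          Periodic n m P → IsHajos m (ModSet P m) Q → IsHajos n P Q
  stepQ : ∀ {n m P Q} .{{_ : NonZero n}} .{{_ : NonZero m}} →
          Factorization n P Q → m < n → m ∣ n →
          Periodic n m Q → IsHajos m P (ModSet Q m) → IsHajos n P Q

NonHajosNumber : (n : ℕ) .{{_ : NonZero n}} → Set₁
NonHajosNumber n = Σ ZSet λ P → Σ ZSet λ Q → Factorization n P Q × (IsHajos n P Q → ⊥)

data Letter : Set where
  a b : Letter

Word : Set
Word = List Letter

IsCode : Pred Word 0ℓ → Set
IsCode C = ∀ (xs ys : List Word) → All C xs → All C ys → concat xs ≡ concat ys → xs ≡ ys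

-- a set of words of the form a^i b a^j, represented by the set of pairs (i , j)
WSet : Set₁
WSet = Pred (ℕ × ℕ) 0ℓ

aba : ℕ × ℕ → Word
aba (i , j) = replicate i a ++ (b ∷ replicate j a)

_≐_ : WSet → WSet → Set
X ≐ Y = ∀ p → X p ⇔ Y p

B : WSet
B p = p ≡ (0 , 0)

Bounded : ℕ → WSet → Set
Bounded m X = ∀ i j → X (i , j) → i < m × j < m

HasSize : ℕ → WSet → Set
HasSize m X = Σ (List (ℕ × ℕ)) λ xs → Unique xs × length xs ≡ m × (∀ p → X p ⇔ p ∈ xs)

WithPower : ℕ → WSet → Pred Word 0ℓ
WithPower n X w = (w ≡ replicate n a) ⊎ (∃ λ p → X p × w ≡ aba p)

IsCbc : ℕ → WSet → Set
IsCbc n X = Bounded n X × HasSize n X × IsCode (WithPower n X)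

compose : (n : ℕ) .{{_ : NonZero n}} → WSet → ℕ → WSet → WSet
compose n X r Y (i , l) = ∃ λ j → ∃ λ k → X (i , j) × Y (k , l) × ((j ℕ.+ k) ℕ.% n ≡ r)

-- X₁ ∘_{r₁} X₂ ∘_{r₂} ⋯ ∘_{r_k} X_{k+1}, rest = [(r₁,X₂), …, (r_k,X_{k+1})]
composeAll : (n : ℕ) .{{_ : NonZero n}} → WSet → List (ℕ × WSet) → WSet
composeAll n X rest = foldl (λ Z rY → compose n Z (Data.Product.proj₁ rY) (Data.Product.proj₂ rY)) X rest

CbcFamily : Set₁
CbcFamily = Pred WSet 0ℓ

Compatible : (n : ℕ) .{{_ : NonZero n}} → CbcFamily → Set₁
Compatible n E =
  ∀ (X : WSet) (rest : List (ℕ × WSet)) → E X →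
    All (λ rY → Data.Product.proj₁ rY < n × E (Data.Product.proj₂ rY)) rest →
    IsCbc n (composeAll n X rest)

Dual : WSet → WSet
Dual X (i , j) = X (j , i)

InH : (t m : ℕ) → WSet → WSet → Set
InH t m X Y =
  Bounded m X × HasSize m X ×
  Σ (ℕ → ℕ → ℕ → ℕ) λ k →
    (∀ i j s → X (i , j) → s < t → k i j s < t) ×
    (∀ u v → Y (u , v) ⇔
       (∃ λ i → ∃ λ j → ∃ λ s → X (i , j) × s < t ×
          (u ≡ i ℕ.+ k i j s ℕ.* m) × (v ≡ j ℕ.+ s ℕ.* m)))

-- Chain m Z [t_i, …, t_k] Y : starting from Z = Y_{i-1} (of size m) there are
-- Y_i, …, Y_{k-1} with dual(Y_l) ∈ H_{t_l}(Y_{l-1}) and Y ∈ H_{t_k}(Y_{k-1}).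
data Chain : ℕ → WSet → List ℕ → WSet → Set₁ where
  last : ∀ {t m Z Y} → InH t m Z Y → Chain m Z (t ∷ []) Y
  step : ∀ {t m Z Z' ts Y} → InH t m Z (Dual Z') → Chain (m ℕ.* t) Z' ts Y →
         Chain m Z (t ∷ ts) Y

IsHajosFamily : ℕ → CbcFamily → Set₁
IsHajosFamily n E =
  (n ≡ 1 × (∀ Y → E Y → Y ≐ B) × (∃ λ Y → E Y × Y ≐ B))
  ⊎ Σ (List ℕ) λ ts → (ts ≡ [] → ⊥) × All (1 <_) ts ×
      ((∀ Y → E Y → Chain 1 B ts Y) ⊎ (∀ Y → E Y → Chain 1 B ts (Dual Y)))

-- The cbc X = {a^(p mod n) b a^(q mod n) : p ∈ P, q ∈ Q} of a factorization (P, Q) of ℤ_n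
-- has n elements, and {a^n} ∪ X is a code: in a product of such words, the number of a's
-- before each b is ≡ p + q (mod n), and a factorization writes every residue uniquely.
-- Since every residue is some p + q, X ∘_r X = X, so {X} is compatible. Conversely, if
-- X ∈ H_t(Z) with t > 1 and |Z| = m, counting gives n = m t; the second exponents of X
-- are the j + s m (s < t), so Q is m-periodic in ℤ_n, Z is the cbc of (P, Q mod m) and
-- the latter is a factorization of size m. Following a Hajós chain of {X} down to {b},
-- swapping P and Q at every dual, therefore yields a Hajós derivation of (P, Q).

module Submission where

open import Data.Bool using (Bool; true; false)
open import Data.Empty using (⊥; ⊥-elim)
open import Data.Fin as Fin using (Fin; toℕ)
import Data.Fin.Properties as FinP
open import Data.Integer as ℤ using (ℤ; +_; _%ℕ_; _/ℕ_; ∣_∣)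
open import Data.Integer.DivMod using (a≡a%ℕn+[a/ℕn]*n; n%ℕd<d)
import Data.Integer.Properties as ℤP
open import Data.Integer.Tactic.RingSolver using (solve-∀)
open import Data.List using (List; []; _∷_; _++_; length; lookup; map; allFin; replicate; concat)
import Data.List.Properties as ListP
open import Data.List.Membership.Propositional using (_∈_)
open import Data.List.Membership.Propositional.Properties using (∈-lookup; ∈-map⁺; ∈-map⁻; ∈-allFin)
open import Data.List.Relation.Unary.All as All using (All)
open import Data.List.Relation.Unary.AllPairs using (_∷_)
import Data.List.Relation.Unary.Any as Any
import Data.List.Relation.Unary.Any.Properties as AnyP
open import Data.List.Relation.Unary.Unique.Propositional using (Unique)
import Data.List.Relation.Unary.Unique.Propositional.Properties as UniqueP
open import Data.Nat as ℕ using (ℕ; NonZero; zero; suc; _<_; _≤_; _∸_; z≤n; s≤s)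
open import Data.Nat.Divisibility using (_∣_; divides; ∣⇒≤)
open import Data.Nat.DivMod using (_%_; _/_; %-distribˡ-+; m%n<n; m<n⇒m%n≡m; [m+kn]%n≡m%n; [m+n]%n≡m%n; m≡m%n+[m/n]*n)
import Data.Nat.Properties as ℕP
import Data.Nat.Tactic.RingSolver as ℕSolver
open import Data.Product using (Σ; ∃; _×_; _,_; proj₁; proj₂; swap)
open import Data.Sum using (_⊎_; inj₁; inj₂)
open import Function.Bundles using (mk⇔; Equivalence)
import Function.Properties.Equivalence as ⇔
open import Relation.Binary.PropositionalEquality
open import Relation.Nullary using (contradiction)

open import Defs

-- Residues of integers

%ℕ-%-idem : ∀ x d .{{_ : NonZero d}} → (x %ℕ d) % d ≡ x %ℕ d
%ℕ-%-idem x d = m<n⇒m%n≡m (n%ℕd<d x d)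

%ℕ-unique : ∀ {x : ℤ} {d} .{{_ : NonZero d}} {r z} → r < d → x ≡ + r ℤ.+ z ℤ.* + d → x %ℕ d ≡ r
%ℕ-unique {x} {d} {r} {z} r<d x≡r+zd = ℤP.+-injective (ℤP.i-j≡0⇒i≡j _ _ r′-r≡0)
  where
  r′ : ℕ
  r′ = x %ℕ d

  z′ : ℤ
  z′ = x /ℕ d

  shape : ∀ a b c e g → a ℤ.- b ≡ ((a ℤ.+ c ℤ.* g) ℤ.- (b ℤ.+ e ℤ.* g)) ℤ.+ (e ℤ.- c) ℤ.* g
  shape = solve-∀

  r′-r≡[z-z′]d : + r′ ℤ.- + r ≡ (z ℤ.- z′) ℤ.* + d
  r′-r≡[z-z′]d = begin
    + r′ ℤ.- + r                                                    ≡⟨ shape (+ r′) (+ r) z′ z (+ d) ⟩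
    (+ r′ ℤ.+ z′ ℤ.* + d ℤ.- (+ r ℤ.+ z ℤ.* + d)) ℤ.+ (z ℤ.- z′) ℤ.* + d
      ≡⟨ cong (λ y → (y ℤ.- (+ r ℤ.+ z ℤ.* + d)) ℤ.+ (z ℤ.- z′) ℤ.* + d) (trans (sym (a≡a%ℕn+[a/ℕn]*n x d)) x≡r+zd) ⟩
    (+ r ℤ.+ z ℤ.* + d ℤ.- (+ r ℤ.+ z ℤ.* + d)) ℤ.+ (z ℤ.- z′) ℤ.* + d
      ≡⟨ cong (ℤ._+ (z ℤ.- z′) ℤ.* + d) (ℤP.+-inverseʳ (+ r ℤ.+ z ℤ.* + d)) ⟩
    ℤ.0ℤ ℤ.+ (z ℤ.- z′) ℤ.* + d                                     ≡⟨ ℤP.+-identityˡ _ ⟩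
    (z ℤ.- z′) ℤ.* + d                                              ∎
    where open ≡-Reasoning

  ∣r′-r∣<d : ∣ + r′ ℤ.- + r ∣ < d
  ∣r′-r∣<d = ℕP.≤-<-trans (subst (λ y → ∣ y ∣ ≤ r′ ℕ.⊔ r) (sym (ℤP.[+m]-[+n]≡m⊖n r′ r)) (ℤP.∣m⊝n∣≤m⊔n r′ r))
                          (ℕP.⊔-lub (n%ℕd<d x d) r<d)

  ∣z-z′∣≡0 : ∣ z ℤ.- z′ ∣ ≡ 0
  ∣z-z′∣≡0 = ℕP.n<1⇒n≡0 (ℕP.*-cancelʳ-< d _ 1
    (subst (_< 1 ℕ.* d) (trans (cong ∣_∣ r′-r≡[z-z′]d) (ℤP.abs-* (z ℤ.- z′) (+ d)))
           (subst (∣ + r′ ℤ.- + r ∣ <_) (sym (ℕP.*-identityˡ d)) ∣r′-r∣<d)))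

  r′-r≡0 : + r′ ℤ.- + r ≡ ℤ.0ℤ
  r′-r≡0 = trans r′-r≡[z-z′]d (trans (cong (ℤ._* + d) (ℤP.∣i∣≡0⇒i≡0 {z ℤ.- z′} ∣z-z′∣≡0)) (ℤP.*-zeroˡ (+ d)))

+-%ℕ : ∀ x y d .{{_ : NonZero d}} → (x ℤ.+ y) %ℕ d ≡ (x %ℕ d ℕ.+ y %ℕ d) % d
+-%ℕ x y d = %ℕ-unique {z = + (S / d) ℤ.+ (x /ℕ d ℤ.+ y /ℕ d)} (m%n<n S d) (begin
    x ℤ.+ y
      ≡⟨ cong₂ ℤ._+_ (a≡a%ℕn+[a/ℕn]*n x d) (a≡a%ℕn+[a/ℕn]*n y d) ⟩
    (+ (x %ℕ d) ℤ.+ x /ℕ d ℤ.* + d) ℤ.+ (+ (y %ℕ d) ℤ.+ y /ℕ d ℤ.* + d)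
      ≡⟨ regroup (+ (x %ℕ d)) (+ (y %ℕ d)) (x /ℕ d) (y /ℕ d) (+ d) ⟩
    + (x %ℕ d) ℤ.+ + (y %ℕ d) ℤ.+ (x /ℕ d ℤ.+ y /ℕ d) ℤ.* + d
      ≡⟨ cong (ℤ._+ (x /ℕ d ℤ.+ y /ℕ d) ℤ.* + d) (sym (ℤP.pos-+ (x %ℕ d) (y %ℕ d))) ⟩
    + S ℤ.+ (x /ℕ d ℤ.+ y /ℕ d) ℤ.* + d
      ≡⟨ cong (λ n → + n ℤ.+ (x /ℕ d ℤ.+ y /ℕ d) ℤ.* + d) (m≡m%n+[m/n]*n S d) ⟩
    + (s ℕ.+ S / d ℕ.* d) ℤ.+ (x /ℕ d ℤ.+ y /ℕ d) ℤ.* + d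
      ≡⟨ cong (ℤ._+ (x /ℕ d ℤ.+ y /ℕ d) ℤ.* + d) (trans (ℤP.pos-+ s _) (cong (λ w → + s ℤ.+ w) (ℤP.pos-* (S / d) d))) ⟩
    + s ℤ.+ + (S / d) ℤ.* + d ℤ.+ (x /ℕ d ℤ.+ y /ℕ d) ℤ.* + d
      ≡⟨ collect (+ s) (+ (S / d)) (x /ℕ d ℤ.+ y /ℕ d) (+ d) ⟩
    + s ℤ.+ (+ (S / d) ℤ.+ (x /ℕ d ℤ.+ y /ℕ d)) ℤ.* + d ∎)
  where
  open ≡-Reasoning

  S s : ℕ
  S = x %ℕ d ℕ.+ y %ℕ d
  s = S % d

  regroup : ∀ a b e f g → (a ℤ.+ e ℤ.* g) ℤ.+ (b ℤ.+ f ℤ.* g) ≡ a ℤ.+ b ℤ.+ (e ℤ.+ f) ℤ.* g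
  regroup = solve-∀

  collect : ∀ a c h g → a ℤ.+ c ℤ.* g ℤ.+ h ℤ.* g ≡ a ℤ.+ (c ℤ.+ h) ℤ.* g
  collect = solve-∀

+-%ℕ-pos : ∀ n x d .{{_ : NonZero d}} → (+ n ℤ.+ x) %ℕ d ≡ (n ℕ.+ x %ℕ d) % d
+-%ℕ-pos n x d = begin
  (+ n ℤ.+ x) %ℕ d                   ≡⟨ +-%ℕ (+ n) x d ⟩
  (n % d ℕ.+ x %ℕ d) % d             ≡⟨ cong (λ r → (n % d ℕ.+ r) % d) (sym (%ℕ-%-idem x d)) ⟩
  (n % d ℕ.+ (x %ℕ d) % d) % d       ≡⟨ sym (%-distribˡ-+ n (x %ℕ d) d) ⟩
  (n ℕ.+ x %ℕ d) % d                 ∎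
  where open ≡-Reasoning

+-%ℕ-congʳ : ∀ x y z d .{{_ : NonZero d}} → y %ℕ d ≡ z %ℕ d → (x ℤ.+ y) %ℕ d ≡ (x ℤ.+ z) %ℕ d
+-%ℕ-congʳ x y z d y≡z = begin
  (x ℤ.+ y) %ℕ d                ≡⟨ +-%ℕ x y d ⟩
  (x %ℕ d ℕ.+ y %ℕ d) % d       ≡⟨ cong (λ r → (x %ℕ d ℕ.+ r) % d) y≡z ⟩
  (x %ℕ d ℕ.+ z %ℕ d) % d       ≡⟨ sym (+-%ℕ x z d) ⟩
  (x ℤ.+ z) %ℕ d                ∎
  where open ≡-Reasoning

[kd+x]%ℕd≡x%ℕd : ∀ k x d .{{_ : NonZero d}} → (+ (k ℕ.* d) ℤ.+ x) %ℕ d ≡ x %ℕ d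
[kd+x]%ℕd≡x%ℕd k x d = begin
  (+ (k ℕ.* d) ℤ.+ x) %ℕ d       ≡⟨ +-%ℕ-pos (k ℕ.* d) x d ⟩
  (k ℕ.* d ℕ.+ x %ℕ d) % d       ≡⟨ cong (_% d) (ℕP.+-comm (k ℕ.* d) (x %ℕ d)) ⟩
  (x %ℕ d ℕ.+ k ℕ.* d) % d       ≡⟨ [m+kn]%n≡m%n (x %ℕ d) k d ⟩
  (x %ℕ d) % d                   ≡⟨ %ℕ-%-idem x d ⟩
  x %ℕ d                         ∎
  where open ≡-Reasoning

%ℕ-%-divisor : ∀ x d m .{{_ : NonZero d}} .{{_ : NonZero m}} → m ∣ d → (x %ℕ d) % m ≡ x %ℕ m
%ℕ-%-divisor x d m (divides e d≡em) = sym (%ℕ-unique {z = + ((x %ℕ d) / m) ℤ.+ x /ℕ d ℤ.* + e} (m%n<n (x %ℕ d) m) (begin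
  x                                                   ≡⟨ a≡a%ℕn+[a/ℕn]*n x d ⟩
  + (x %ℕ d) ℤ.+ x /ℕ d ℤ.* + d
    ≡⟨ cong₂ (λ u v → + u ℤ.+ x /ℕ d ℤ.* + v) (m≡m%n+[m/n]*n (x %ℕ d) m) d≡em ⟩
  + (r ℕ.+ c ℕ.* m) ℤ.+ x /ℕ d ℤ.* + (e ℕ.* m)
    ≡⟨ cong₂ (λ u v → u ℤ.+ x /ℕ d ℤ.* v) (trans (ℤP.pos-+ r (c ℕ.* m)) (cong (λ w → + r ℤ.+ w) (ℤP.pos-* c m))) (ℤP.pos-* e m) ⟩
  + r ℤ.+ + c ℤ.* + m ℤ.+ x /ℕ d ℤ.* (+ e ℤ.* + m)    ≡⟨ collect (+ r) (+ c) (x /ℕ d) (+ e) (+ m) ⟩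
  + r ℤ.+ (+ c ℤ.+ x /ℕ d ℤ.* + e) ℤ.* + m            ∎))
  where
  open ≡-Reasoning
  r c : ℕ
  r = (x %ℕ d) % m
  c = (x %ℕ d) / m

  collect : ∀ a b q f g → a ℤ.+ b ℤ.* g ℤ.+ q ℤ.* (f ℤ.* g) ≡ a ℤ.+ (b ℤ.+ q ℤ.* f) ℤ.* g
  collect = solve-∀

%ℕ-divisor-digit : ∀ {d m i} x q .{{_ : NonZero d}} .{{_ : NonZero m}} → m ∣ d → i < m →
                   x %ℕ d ≡ i ℕ.+ q ℕ.* m → x %ℕ m ≡ i
%ℕ-divisor-digit {d} {m} {i} x q m∣d i<m x≡i+qm = begin
  x %ℕ m                  ≡⟨ sym (%ℕ-%-divisor x d m m∣d) ⟩
  (x %ℕ d) % m            ≡⟨ cong (_% m) x≡i+qm ⟩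
  (i ℕ.+ q ℕ.* m) % m     ≡⟨ [m+kn]%n≡m%n i q m ⟩
  i % m                   ≡⟨ m<n⇒m%n≡m i<m ⟩
  i                       ∎
  where open ≡-Reasoning

divMod-injective : ∀ {m i i′ q q′} → i < m → i′ < m → i ℕ.+ q ℕ.* m ≡ i′ ℕ.+ q′ ℕ.* m → i ≡ i′ × q ≡ q′
divMod-injective {m@(suc _)} {i} {i′} {q} {q′} i<m i′<m eq = i≡i′ ,
  ℕP.*-cancelʳ-≡ q q′ m (ℕP.+-cancelˡ-≡ i _ _ (trans eq (cong (ℕ._+ q′ ℕ.* m) (sym i≡i′))))
  where
  i≡i′ : i ≡ i′
  i≡i′ = begin
    i                      ≡⟨ sym (m<n⇒m%n≡m i<m) ⟩
    i % m                  ≡⟨ sym ([m+kn]%n≡m%n i q m) ⟩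
    (i ℕ.+ q ℕ.* m) % m    ≡⟨ cong (_% m) eq ⟩
    (i′ ℕ.+ q′ ℕ.* m) % m  ≡⟨ [m+kn]%n≡m%n i′ q′ m ⟩
    i′ % m                 ≡⟨ m<n⇒m%n≡m i′<m ⟩
    i′                     ∎
    where open ≡-Reasoning

-- Counting the sets H_t(Z)

lookup-injective : ∀ {A : Set} {xs : List A} → Unique xs → ∀ i j → lookup xs i ≡ lookup xs j → i ≡ j
lookup-injective (_ ∷ _)     Fin.zero    Fin.zero    _  = refl
lookup-injective (x∉ ∷ _)    Fin.zero    (Fin.suc j) eq = contradiction eq (All.lookup x∉ (∈-lookup j))
lookup-injective (x∉ ∷ _)    (Fin.suc i) Fin.zero    eq = contradiction (sym eq) (All.lookup x∉ (∈-lookup i))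
lookup-injective (_ ∷ uniq)  (Fin.suc i) (Fin.suc j) eq = cong Fin.suc (lookup-injective uniq i j eq)

index-injective : ∀ {A : Set} {xs : List A} {x y} (p : x ∈ xs) (q : y ∈ xs) → Any.index p ≡ Any.index q → x ≡ y
index-injective {xs = xs} p q eq = trans (AnyP.lookup-index p) (trans (cong (lookup xs) eq) (sym (AnyP.lookup-index q)))

inH-size : ∀ {t m N Z Y} → InH t m Z Y → HasSize N Y → N ≡ m ℕ.* t
inH-size {t} {m} {N} {Z} {Y} (Z-bounded , (zs , zs-unique , zs-length , zs-mem) , k , _ , Y-def)
                            (ys , ys-unique , ys-length , ys-mem) =
  trans (sym ys-length)
    (trans (FinP.cantor-schröder-bernstein {f = classify} {g = generate} classify-injective generate-injective)
           (cong (ℕ._* t) zs-length))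
  where
  Coordinates : ℕ × ℕ → Set
  Coordinates (u , v) = ∃ λ i → ∃ λ j → ∃ λ s → Z (i , j) × s < t ×
                          u ≡ i ℕ.+ k i j s ℕ.* m × v ≡ j ℕ.+ s ℕ.* m

  coordinates : ∀ c → Coordinates (lookup ys c)
  coordinates c = Equivalence.to (Y-def _ _) (Equivalence.from (ys-mem _) (∈-lookup c))

  baseAndLevel : ∀ {y} → Coordinates y → Fin (length zs ℕ.* t)
  baseAndLevel (_ , _ , _ , z , s<t , _) = Fin.combine (Any.index (Equivalence.to (zs-mem _) z)) (Fin.fromℕ< s<t)

  classify : Fin (length ys) → Fin (length zs ℕ.* t)
  classify c = baseAndLevel (coordinates c)

  classify-injective : ∀ {c c′} → classify c ≡ classify c′ → c ≡ c′
  classify-injective {c} {c′} eq with coordinates c | coordinates c′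
  ... | i , j , s , z , s<t , u≡ , v≡ | i′ , j′ , s′ , z′ , s′<t , u′≡ , v′≡
    with refl ← index-injective (Equivalence.to (zs-mem _) z) (Equivalence.to (zs-mem _) z′)
                  (FinP.combine-injectiveˡ {length zs} _ _ _ _ eq)
       | refl ← trans (sym (FinP.toℕ-fromℕ< s<t))
                  (trans (cong toℕ (FinP.combine-injectiveʳ {length zs} _ _ _ _ eq)) (FinP.toℕ-fromℕ< s′<t))
    = lookup-injective ys-unique c c′ (cong₂ _,_ (trans u≡ (sym u′≡)) (trans v≡ (sym v′≡)))

  element : Fin (length zs) → Fin t → ℕ × ℕ
  element ρ σ = let (i , j) = lookup zs ρ in i ℕ.+ k i j (toℕ σ) ℕ.* m , j ℕ.+ toℕ σ ℕ.* m

  element∈ys : ∀ ρ σ → element ρ σ ∈ ys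
  element∈ys ρ σ = Equivalence.to (ys-mem _) (Equivalence.from (Y-def _ _)
    (_ , _ , toℕ σ , Equivalence.from (zs-mem _) (∈-lookup ρ) , FinP.toℕ<n σ , refl , refl))

  element-injective : ∀ {ρ ρ′ σ σ′} → element ρ σ ≡ element ρ′ σ′ → ρ ≡ ρ′ × σ ≡ σ′
  element-injective {ρ} {ρ′} {σ} {σ′} eq
    with i<m , j<m ← Z-bounded _ _ (Equivalence.from (zs-mem _) (∈-lookup ρ))
       | i′<m , j′<m ← Z-bounded _ _ (Equivalence.from (zs-mem _) (∈-lookup ρ′))
    with i≡i′ , _ ← divMod-injective {q = k _ _ (toℕ σ)} {q′ = k _ _ (toℕ σ′)} i<m i′<m (cong proj₁ eq)
       | j≡j′ , σ≡σ′ ← divMod-injective j<m j′<m (cong proj₂ eq)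
    = lookup-injective zs-unique ρ ρ′ (cong₂ _,_ i≡i′ j≡j′) , FinP.toℕ-injective σ≡σ′

  generate : Fin (length zs ℕ.* t) → Fin (length ys)
  generate c = let (ρ , σ) = Fin.remQuot t c in Any.index (element∈ys ρ σ)

  generate-injective : ∀ {c c′} → generate c ≡ generate c′ → c ≡ c′
  generate-injective {c} {c′} eq =
    let (ρ≡ρ′ , σ≡σ′) = element-injective (index-injective (element∈ys _ _) (element∈ys _ _) eq) in
    trans (sym (FinP.combine-remQuot {length zs} t c))
      (trans (cong₂ Fin.combine ρ≡ρ′ σ≡σ′) (FinP.combine-remQuot {length zs} t c′))

-- Words a^i b a^j

leadingAs : Word → ℕ
leadingAs []      = 0
leadingAs (a ∷ w) = suc (leadingAs w)
leadingAs (b ∷ _) = 0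

containsB : Word → Bool
containsB []      = false
containsB (a ∷ w) = containsB w
containsB (b ∷ _) = true

leadingAs-a^k++ : ∀ k w → leadingAs (replicate k a ++ w) ≡ k ℕ.+ leadingAs w
leadingAs-a^k++ zero    w = refl
leadingAs-a^k++ (suc k) w = cong suc (leadingAs-a^k++ k w)

containsB-a^k++ : ∀ k w → containsB (replicate k a ++ w) ≡ containsB w
containsB-a^k++ zero    w = refl
containsB-a^k++ (suc k) w = containsB-a^k++ k w

leadingAs-a^N++-% : ∀ N .{{_ : NonZero N}} w → leadingAs (replicate N a ++ w) % N ≡ leadingAs w % N
leadingAs-a^N++-% N w = trans (cong (_% N) (trans (leadingAs-a^k++ N w) (ℕP.+-comm N _))) ([m+n]%n≡m%n _ N)

aba-++ : ∀ i j w → aba (i , j) ++ w ≡ replicate i a ++ b ∷ replicate j a ++ w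
aba-++ i j w = ListP.++-assoc (replicate i a) (b ∷ replicate j a) w

leadingAs-aba++ : ∀ i j w → leadingAs (aba (i , j) ++ w) ≡ i
leadingAs-aba++ i j w = trans (cong leadingAs (aba-++ i j w)) (trans (leadingAs-a^k++ i _) (ℕP.+-identityʳ i))

a^N++≢aba++ : ∀ {N i j w w′} → i < N → replicate N a ++ w ≢ aba (i , j) ++ w′
a^N++≢aba++ {N} {i} {j} {w} {w′} i<N eq = ℕP.<⇒≱ i<N (begin
  N                                ≤⟨ ℕP.m≤m+n N (leadingAs w) ⟩
  N ℕ.+ leadingAs w                ≡⟨ sym (leadingAs-a^k++ N w) ⟩
  leadingAs (replicate N a ++ w)   ≡⟨ cong leadingAs eq ⟩
  leadingAs (aba (i , j) ++ w′)    ≡⟨ leadingAs-aba++ i j w′ ⟩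
  i                                ∎)
  where open ℕP.≤-Reasoning

withPower-nonempty : ∀ {N X w} .{{_ : NonZero N}} → WithPower N X w → w ≢ []
withPower-nonempty {N} (inj₁ refl) eq = ℕ.≢-nonZero⁻¹ N (trans (sym (ListP.length-replicate N)) (cong length eq))
withPower-nonempty (inj₂ ((zero , _) , _ , refl)) = λ ()
withPower-nonempty (inj₂ ((suc _ , _) , _ , refl)) = λ ()

-- The cbc of a factorization

≐-refl : ∀ {X} → X ≐ X
≐-refl _ = ⇔.refl

≐-sym : ∀ {X Y} → X ≐ Y → Y ≐ X
≐-sym X≐Y p = ⇔.sym (X≐Y p)

≐-trans : ∀ {X Y Z} → X ≐ Y → Y ≐ Z → X ≐ Z
≐-trans X≐Y Y≐Z p = ⇔.trans (X≐Y p) (Y≐Z p)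

hasSize-resp-≐ : ∀ {n X Y} → X ≐ Y → HasSize n X → HasSize n Y
hasSize-resp-≐ X≐Y (xs , unique , length≡ , xs-mem) = xs , unique , length≡ , λ p → ⇔.trans (⇔.sym (X≐Y p)) (xs-mem p)

isCbc-resp-≐ : ∀ {n X Y} → X ≐ Y → IsCbc n X → IsCbc n Y
isCbc-resp-≐ {n} {X} {Y} X≐Y (bounded , size , code) =
  (λ i j Yij → bounded i j (Equivalence.from (X≐Y _) Yij)) ,
  hasSize-resp-≐ X≐Y size ,
  λ ws ws′ Yws Yws′ → code ws ws′ (All.map toX Yws) (All.map toX Yws′)
  where
  toX : ∀ {w} → WithPower n Y w → WithPower n X w
  toX (inj₁ w≡a^n)          = inj₁ w≡a^n
  toX (inj₂ (p , Yp , w≡)) = inj₂ (p , Equivalence.from (X≐Y p) Yp , w≡)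

cbcOf : (N : ℕ) .{{_ : NonZero N}} → ZSet → ZSet → WSet
cbcOf N P Q (i , j) = ∃ λ p → ∃ λ q → P p × Q q × i ≡ p %ℕ N × j ≡ q %ℕ N

cbcOf-bounded : ∀ N .{{_ : NonZero N}} P Q → Bounded N (cbcOf N P Q)
cbcOf-bounded N P Q _ _ (p , q , _ , _ , refl , refl) = n%ℕd<d p N , n%ℕd<d q N

module _ {N : ℕ} .{{_ : NonZero N}} {P Q : ZSet} (fac : Factorization N P Q) where

  factorization-injective : ∀ {p q p′ q′} → P p → Q q → P p′ → Q q′ →
                            (p ℤ.+ q) %ℕ N ≡ (p′ ℤ.+ q′) %ℕ N → p ≡ p′ × q ≡ q′
  factorization-injective {p} {q} {p′} {q′} Pp Qq Pp′ Qq′ eq =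
    let (_ , _ , _ , _ , _ , unique) = fac ((p ℤ.+ q) %ℕ N) (n%ℕd<d (p ℤ.+ q) N)
        (p≡ , q≡) = unique p q Pp Qq refl
        (p′≡ , q′≡) = unique p′ q′ Pp′ Qq′ (sym eq)
    in trans p≡ (sym p′≡) , trans q≡ (sym q′≡)

  cbcOf-size : HasSize N (cbcOf N P Q)
  cbcOf-size = map pair (allFin N) ,
               UniqueP.map⁺ pair-injective (UniqueP.allFin⁺ N) ,
               trans (ListP.length-map pair (allFin N)) (ListP.length-tabulate (λ c → c)) ,
               λ _ → mk⇔ to from
    where
    pair : Fin N → ℕ × ℕ
    pair c = let (p , q , _) = fac (toℕ c) (FinP.toℕ<n c) in p %ℕ N , q %ℕ N

    pair-injective : ∀ {c c′} → pair c ≡ pair c′ → c ≡ c′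
    pair-injective {c} {c′} eq =
      let (p , q , _ , _ , p+q≡c , _) = fac (toℕ c) (FinP.toℕ<n c)
          (p′ , q′ , _ , _ , p′+q′≡c′ , _) = fac (toℕ c′) (FinP.toℕ<n c′)
      in FinP.toℕ-injective (begin
        toℕ c                            ≡⟨ sym p+q≡c ⟩
        (p ℤ.+ q) %ℕ N                   ≡⟨ +-%ℕ p q N ⟩
        (p %ℕ N ℕ.+ q %ℕ N) % N          ≡⟨ cong (λ (u , v) → (u ℕ.+ v) % N) eq ⟩
        (p′ %ℕ N ℕ.+ q′ %ℕ N) % N        ≡⟨ sym (+-%ℕ p′ q′ N) ⟩
        (p′ ℤ.+ q′) %ℕ N                 ≡⟨ p′+q′≡c′ ⟩
        toℕ c′                           ∎)
      where open ≡-Reasoning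

    to : ∀ {x} → cbcOf N P Q x → x ∈ map pair (allFin N)
    to (p , q , Pp , Qq , refl , refl) =
      let c = Fin.fromℕ< (n%ℕd<d (p ℤ.+ q) N)
          (_ , _ , Pp′ , Qq′ , p′+q′≡c , _) = fac (toℕ c) (FinP.toℕ<n c)
          (p′≡p , q′≡q) = factorization-injective Pp′ Qq′ Pp Qq (trans p′+q′≡c (FinP.toℕ-fromℕ< _))
      in subst (_∈ map pair (allFin N)) (cong₂ (λ u v → u %ℕ N , v %ℕ N) p′≡p q′≡q) (∈-map⁺ pair (∈-allFin c))

    from : ∀ {x} → x ∈ map pair (allFin N) → cbcOf N P Q x
    from x∈ with c , _ , refl ← ∈-map⁻ pair x∈ =
      let (p , q , Pp , Qq , _) = fac (toℕ c) (FinP.toℕ<n c) in p , q , Pp , Qq , refl , refl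

  LeadingRun : Word → Set
  LeadingRun w = (containsB w ≡ false × leadingAs w % N ≡ 0)
               ⊎ (containsB w ≡ true × ∃ λ p → P p × leadingAs w % N ≡ p %ℕ N)

  concat-leadingRun : ∀ {xs} → All (WithPower N (cbcOf N P Q)) xs → LeadingRun (concat xs)
  concat-leadingRun All.[] = inj₁ (refl , m<n⇒m%n≡m (ℕ.>-nonZero⁻¹ N))
  concat-leadingRun {_ ∷ xs} (inj₁ refl All.∷ ws) with concat-leadingRun ws
  ... | inj₁ (noB , run) = inj₁ (trans (containsB-a^k++ N (concat xs)) noB , trans (leadingAs-a^N++-% N (concat xs)) run)
  ... | inj₂ (hasB , run) = inj₂ (trans (containsB-a^k++ N (concat xs)) hasB , proj₁ run , proj₁ (proj₂ run) ,
                                  trans (leadingAs-a^N++-% N (concat xs)) (proj₂ (proj₂ run)))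
  concat-leadingRun {_ ∷ xs} (inj₂ (_ , (p , q , Pp , _ , refl , refl) , refl) All.∷ _) =
    inj₂ (trans (cong containsB (aba-++ (p %ℕ N) (q %ℕ N) (concat xs))) (containsB-a^k++ (p %ℕ N) _) ,
          p , Pp , trans (cong (_% N) (leadingAs-aba++ (p %ℕ N) (q %ℕ N) (concat xs))) (%ℕ-%-idem p N))


  a^q-prefix-injective : ∀ {q q′ R R′} → Q q → Q q′ → LeadingRun R → LeadingRun R′ →
                         replicate (q %ℕ N) a ++ R ≡ replicate (q′ %ℕ N) a ++ R′ → q %ℕ N ≡ q′ %ℕ N
  a^q-prefix-injective {q} {q′} {R} {R′} Qq Qq′ runR runR′ eq = compare runR runR′
    where
    open ≡-Reasoning

    split : ∀ x w → (x %ℕ N ℕ.+ leadingAs w) % N ≡ (x %ℕ N ℕ.+ leadingAs w % N) % N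
    split x w = trans (%-distribˡ-+ (x %ℕ N) (leadingAs w) N)
                      (cong (λ r → (r ℕ.+ leadingAs w % N) % N) (%ℕ-%-idem x N))

    sameB : containsB R ≡ containsB R′
    sameB = trans (sym (containsB-a^k++ (q %ℕ N) R)) (trans (cong containsB eq) (containsB-a^k++ (q′ %ℕ N) R′))

    sameRun : (q %ℕ N ℕ.+ leadingAs R % N) % N ≡ (q′ %ℕ N ℕ.+ leadingAs R′ % N) % N
    sameRun = begin
      (q %ℕ N ℕ.+ leadingAs R % N) % N    ≡⟨ sym (split q R) ⟩
      (q %ℕ N ℕ.+ leadingAs R) % N        ≡⟨ cong (_% N) (sym (leadingAs-a^k++ (q %ℕ N) R)) ⟩
      leadingAs (replicate (q %ℕ N) a ++ R) % N    ≡⟨ cong (λ w → leadingAs w % N) eq ⟩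
      leadingAs (replicate (q′ %ℕ N) a ++ R′) % N  ≡⟨ cong (_% N) (leadingAs-a^k++ (q′ %ℕ N) R′) ⟩
      (q′ %ℕ N ℕ.+ leadingAs R′) % N      ≡⟨ split q′ R′ ⟩
      (q′ %ℕ N ℕ.+ leadingAs R′ % N) % N  ∎

    plusZero : ∀ x → (x %ℕ N ℕ.+ 0) % N ≡ x %ℕ N
    plusZero x = trans (cong (_% N) (ℕP.+-identityʳ (x %ℕ N))) (%ℕ-%-idem x N)

    plusP : ∀ {x p w} → leadingAs w % N ≡ p %ℕ N → (p ℤ.+ x) %ℕ N ≡ (x %ℕ N ℕ.+ leadingAs w % N) % N
    plusP {x} {p} run≡p = trans (+-%ℕ p x N)
      (trans (cong (_% N) (ℕP.+-comm (p %ℕ N) (x %ℕ N))) (cong (λ r → (x %ℕ N ℕ.+ r) % N) (sym run≡p)))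

    compare : LeadingRun R → LeadingRun R′ → q %ℕ N ≡ q′ %ℕ N
    compare (inj₁ (_ , run≡0)) (inj₁ (_ , run′≡0)) = begin
      q %ℕ N                              ≡⟨ sym (plusZero q) ⟩
      (q %ℕ N ℕ.+ 0) % N                  ≡⟨ cong (λ r → (q %ℕ N ℕ.+ r) % N) (sym run≡0) ⟩
      (q %ℕ N ℕ.+ leadingAs R % N) % N    ≡⟨ sameRun ⟩
      (q′ %ℕ N ℕ.+ leadingAs R′ % N) % N  ≡⟨ cong (λ r → (q′ %ℕ N ℕ.+ r) % N) run′≡0 ⟩
      (q′ %ℕ N ℕ.+ 0) % N                 ≡⟨ plusZero q′ ⟩
      q′ %ℕ N                             ∎
    compare (inj₁ (noB , _)) (inj₂ (hasB , _)) = contradiction (trans (sym noB) (trans sameB hasB)) λ ()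
    compare (inj₂ (hasB , _)) (inj₁ (noB , _)) = contradiction (trans (sym noB) (trans (sym sameB) hasB)) λ ()
    compare (inj₂ (_ , p , Pp , run≡p)) (inj₂ (_ , p′ , Pp′ , run′≡p′)) =
      cong (_%ℕ N) (proj₂ (factorization-injective Pp Qq Pp′ Qq′
        (trans (plusP {q} {p} run≡p) (trans sameRun (sym (plusP {q′} {p′} run′≡p′))))))

  head-unique : ∀ {x y xs ys} → WithPower N (cbcOf N P Q) x → WithPower N (cbcOf N P Q) y →
                All (WithPower N (cbcOf N P Q)) xs → All (WithPower N (cbcOf N P Q)) ys →
                x ++ concat xs ≡ y ++ concat ys → x ≡ y
  head-unique (inj₁ refl) (inj₁ refl) _ _ _ = refl
  head-unique (inj₁ refl) (inj₂ (_ , (p , _ , _ , _ , refl , refl) , refl)) _ _ eq =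
    ⊥-elim (a^N++≢aba++ (n%ℕd<d p N) eq)
  head-unique (inj₂ (_ , (p , _ , _ , _ , refl , refl) , refl)) (inj₁ refl) _ _ eq =
    ⊥-elim (a^N++≢aba++ (n%ℕd<d p N) (sym eq))
  head-unique {xs = xs} {ys} (inj₂ (_ , (p , q , _ , Qq , refl , refl) , refl))
                             (inj₂ (_ , (p′ , q′ , _ , Qq′ , refl , refl) , refl)) ws ws′ eq =
    cong₂ (λ i j → aba (i , j)) i≡i′ j≡j′
    where
    i≡i′ : p %ℕ N ≡ p′ %ℕ N
    i≡i′ = trans (sym (leadingAs-aba++ _ _ (concat xs))) (trans (cong leadingAs eq) (leadingAs-aba++ _ _ (concat ys)))

    afterB : replicate (q %ℕ N) a ++ concat xs ≡ replicate (q′ %ℕ N) a ++ concat ys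
    afterB = ListP.∷-injectiveʳ (ListP.++-cancelˡ (replicate (p %ℕ N) a) _ _
      (trans (sym (aba-++ _ _ (concat xs)))
        (trans eq (trans (aba-++ _ _ (concat ys)) (cong (λ i → replicate i a ++ _) (sym i≡i′))))))

    j≡j′ : q %ℕ N ≡ q′ %ℕ N
    j≡j′ = a^q-prefix-injective Qq Qq′ (concat-leadingRun ws) (concat-leadingRun ws′) afterB

  cbcOf-code : IsCode (WithPower N (cbcOf N P Q))
  cbcOf-code []       []       _            _            _  = refl
  cbcOf-code []       (y ∷ ys) _            (wy All.∷ _) eq = ⊥-elim (withPower-nonempty wy (ListP.++-conicalˡ y _ (sym eq)))
  cbcOf-code (x ∷ xs) []       (wx All.∷ _) _            eq = ⊥-elim (withPower-nonempty wx (ListP.++-conicalˡ x _ eq))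
  cbcOf-code (x ∷ xs) (y ∷ ys) (wx All.∷ wxs) (wy All.∷ wys) eq with refl ← head-unique wx wy wxs wys eq =
    cong (x ∷_) (cbcOf-code xs ys wxs wys (ListP.++-cancelˡ x _ _ eq))

  cbcOf-isCbc : IsCbc N (cbcOf N P Q)
  cbcOf-isCbc = cbcOf-bounded N P Q , cbcOf-size , cbcOf-code

  cbcOf-compose : ∀ {Z Y r} → r < N → Z ≐ cbcOf N P Q → Y ≐ cbcOf N P Q → compose N Z r Y ≐ cbcOf N P Q
  cbcOf-compose {Z} {Y} {r} r<N Z≐X Y≐X _ = mk⇔ to from
    where
    to : ∀ {x} → compose N Z r Y x → cbcOf N P Q x
    to (_ , _ , Zij , Ykl , _)
      with p , _ , Pp , _ , refl , refl ← Equivalence.to (Z≐X _) Zij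
         | _ , q , _ , Qq , refl , refl ← Equivalence.to (Y≐X _) Ykl
      = p , q , Pp , Qq , refl , refl

    from : ∀ {x} → cbcOf N P Q x → compose N Z r Y x
    from (p , q , Pp , Qq , refl , refl) =
      let (p₀ , q₀ , Pp₀ , Qq₀ , p₀+q₀≡r , _) = fac r r<N in
      q₀ %ℕ N , p₀ %ℕ N ,
      Equivalence.from (Z≐X _) (p , q₀ , Pp , Qq₀ , refl , refl) ,
      Equivalence.from (Y≐X _) (p₀ , q , Pp₀ , Qq , refl , refl) ,
      trans (sym (+-%ℕ q₀ p₀ N)) (trans (cong (_%ℕ N) (ℤP.+-comm q₀ p₀)) p₀+q₀≡r)

  cbcOf-composeAll : ∀ rest {Z} → Z ≐ cbcOf N P Q →
                     All (λ (r , Y) → r < N × Y ≐ cbcOf N P Q) rest → composeAll N Z rest ≐ cbcOf N P Q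
  cbcOf-composeAll []         Z≐X All.[]                       = Z≐X
  cbcOf-composeAll (_ ∷ rest) Z≐X ((r<N , Y≐X) All.∷ rest≐X) =
    cbcOf-composeAll rest (cbcOf-compose r<N Z≐X Y≐X) rest≐X

  cbcOf-compatible : Compatible N (_≐ cbcOf N P Q)
  cbcOf-compatible _ rest Z≐X rest≐X = isCbc-resp-≐ (≐-sym (cbcOf-composeAll rest Z≐X rest≐X)) cbcOf-isCbc

-- Periodicity and Hajós factorizations

factorization-swap : ∀ {n P Q} .{{_ : NonZero n}} → Factorization n P Q → Factorization n Q P
factorization-swap {n} fac k k<n =
  let (p , q , Pp , Qq , p+q≡k , unique) = fac k k<n in
  q , p , Qq , Pp , trans (cong (_%ℕ n) (ℤP.+-comm q p)) p+q≡k ,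
  λ q′ p′ Qq′ Pp′ q′+p′≡k → swap (unique p′ q′ Pp′ Qq′ (trans (cong (_%ℕ n) (ℤP.+-comm p′ q′)) q′+p′≡k))

isHajos-swap : ∀ {n P Q} → IsHajos n P Q → IsHajos n Q P
isHajos-swap (base fac)                 = base (factorization-swap fac)
isHajos-swap (stepP fac m<n m∣n per h) = stepQ (factorization-swap fac) m<n m∣n per (isHajos-swap h)
isHajos-swap (stepQ fac m<n m∣n per h) = stepP (factorization-swap fac) m<n m∣n per (isHajos-swap h)

hajos-of-size-1 : ∀ {n P Q} .{{_ : NonZero n}} → n ≡ 1 → Factorization n P Q → IsHajos n P Q
hajos-of-size-1 refl fac = base fac

ShiftClosed : (N : ℕ) .{{_ : NonZero N}} → ℕ → ZSet → Set
ShiftClosed N m Q = ∀ {u} → Q u → ∃ λ u′ → Q u′ × u′ %ℕ N ≡ (+ m ℤ.+ u) %ℕ N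

module _ {N m : ℕ} .{{_ : NonZero N}} {Q : ZSet} (closed : ShiftClosed N m Q) where

  shiftClosed-iterate : ∀ {u} → Q u → ∀ c → ∃ λ u′ → Q u′ × u′ %ℕ N ≡ (+ (c ℕ.* m) ℤ.+ u) %ℕ N
  shiftClosed-iterate {u} Qu zero = u , Qu , cong (_%ℕ N) (sym (ℤP.+-identityˡ u))
  shiftClosed-iterate {u} Qu (suc c) =
    let (u′ , Qu′ , u′≡) = shiftClosed-iterate Qu c
        (u″ , Qu″ , u″≡) = closed Qu′
    in u″ , Qu″ , (begin
      u″ %ℕ N                                ≡⟨ u″≡ ⟩
      (+ m ℤ.+ u′) %ℕ N                      ≡⟨ +-%ℕ-congʳ (+ m) u′ (+ (c ℕ.* m) ℤ.+ u) N u′≡ ⟩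
      (+ m ℤ.+ (+ (c ℕ.* m) ℤ.+ u)) %ℕ N     ≡⟨ cong (_%ℕ N) (sym (ℤP.+-assoc (+ m) (+ (c ℕ.* m)) u)) ⟩
      (+ m ℤ.+ + (c ℕ.* m) ℤ.+ u) %ℕ N       ≡⟨ cong (λ x → (x ℤ.+ u) %ℕ N) (sym (ℤP.pos-+ m (c ℕ.* m))) ⟩
      (+ (suc c ℕ.* m) ℤ.+ u) %ℕ N           ∎)
    where open ≡-Reasoning

  shiftClosed⇒periodic : m ∣ N → Periodic N m Q
  shiftClosed⇒periodic (divides e N≡em) r = mk⇔
    (λ (u , Qu , m+u≡r) → let (u′ , Qu′ , u′≡) = closed Qu in u′ , Qu′ , trans u′≡ m+u≡r)
    (λ (u , Qu , u≡r) → back e N≡em Qu u≡r)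
    where
    open ≡-Reasoning
    back : ∀ e → N ≡ e ℕ.* m → ∀ {u} → Q u → u %ℕ N ≡ r → ∃ λ u′ → Q u′ × (+ m ℤ.+ u′) %ℕ N ≡ r
    back zero    N≡0 _ _ = contradiction N≡0 (ℕ.≢-nonZero⁻¹ N)
    back (suc e) N≡m+em {u} Qu u≡r =
      let (u′ , Qu′ , u′≡) = shiftClosed-iterate Qu e in u′ , Qu′ , (begin
        (+ m ℤ.+ u′) %ℕ N                       ≡⟨ +-%ℕ-congʳ (+ m) u′ (+ (e ℕ.* m) ℤ.+ u) N u′≡ ⟩
        (+ m ℤ.+ (+ (e ℕ.* m) ℤ.+ u)) %ℕ N      ≡⟨ cong (_%ℕ N) (sym (ℤP.+-assoc (+ m) (+ (e ℕ.* m)) u)) ⟩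
        (+ m ℤ.+ + (e ℕ.* m) ℤ.+ u) %ℕ N        ≡⟨ cong (λ x → (x ℤ.+ u) %ℕ N) (sym (ℤP.pos-+ m (e ℕ.* m))) ⟩
        (+ (m ℕ.+ e ℕ.* m) ℤ.+ u) %ℕ N          ≡⟨ cong (λ x → (+ x ℤ.+ u) %ℕ N) (sym (trans (ℕP.*-identityˡ N) N≡m+em)) ⟩
        (+ (1 ℕ.* N) ℤ.+ u) %ℕ N                ≡⟨ [kd+x]%ℕd≡x%ℕd 1 u N ⟩
        u %ℕ N                                  ≡⟨ u≡r ⟩
        r                                       ∎)

  shiftClosed⇒factorization-mod : ∀ {P} .{{_ : NonZero m}} → m ∣ N → Factorization N P Q →
                                  Factorization m P (ModSet Q m)
  shiftClosed⇒factorization-mod {P} m∣N@(divides e N≡em) fac k k<m =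
    let (p , q , Pp , Qq , p+q≡k , unique) = fac k k<N in
    p , + (q %ℕ m) , Pp , (q , Qq , refl) , sum-residue {p} {q} p+q≡k , reduced-unique unique
    where
    open ≡-Reasoning

    k<N : k < N
    k<N = ℕP.<-≤-trans k<m (∣⇒≤ m∣N)

    reduce : ∀ x y → (x ℤ.+ + (y %ℕ m)) %ℕ m ≡ (x ℤ.+ y) %ℕ m
    reduce x y = +-%ℕ-congʳ x (+ (y %ℕ m)) y m (%ℕ-%-idem y m)

    sum-residue : ∀ {p q} → (p ℤ.+ q) %ℕ N ≡ k → (p ℤ.+ + (q %ℕ m)) %ℕ m ≡ k
    sum-residue {p} {q} p+q≡k = begin
      (p ℤ.+ + (q %ℕ m)) %ℕ m  ≡⟨ reduce p q ⟩
      (p ℤ.+ q) %ℕ m           ≡⟨ sym (%ℕ-%-divisor (p ℤ.+ q) N m m∣N) ⟩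
      ((p ℤ.+ q) %ℕ N) % m     ≡⟨ cong (_% m) p+q≡k ⟩
      k % m                    ≡⟨ m<n⇒m%n≡m k<m ⟩
      k                        ∎

    reduced-unique : ∀ {p q} → (∀ p′ q′ → P p′ → Q q′ → (p′ ℤ.+ q′) %ℕ N ≡ k → p′ ≡ p × q′ ≡ q) →
                     ∀ p′ q′ → P p′ → ModSet Q m q′ → (p′ ℤ.+ q′) %ℕ m ≡ k → p′ ≡ p × q′ ≡ + (q %ℕ m)
    -- Shifting q′ by d m makes p′ + q″ ≡ k (mod N), where uniqueness applies.
    reduced-unique {p} {q} unique p′ _ Pp′ (q′ , Qq′ , refl) p′+q′≡k =
      let (q″ , Qq″ , q″≡) = shiftClosed-iterate Qq′ d
          (p′≡p , q″≡q) = unique p′ q″ Pp′ Qq″ (shifted-sum {q″} q″≡)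
      in p′≡p , cong +_ (trans (residue-preserved {q″} q″≡) (cong (_%ℕ m) q″≡q))
      where
      w : ℕ
      w = (p′ ℤ.+ q′) %ℕ N

      w≡k+cm : w ≡ k ℕ.+ (w / m) ℕ.* m
      w≡k+cm = trans (m≡m%n+[m/n]*n w m)
                 (cong (ℕ._+ (w / m) ℕ.* m) (trans (%ℕ-%-divisor (p′ ℤ.+ q′) N m m∣N) (trans (sym (reduce p′ q′)) p′+q′≡k)))

      w/m<e : w / m < e
      w/m<e = ℕP.*-cancelʳ-< m (w / m) e
        (ℕP.≤-<-trans (ℕP.m≤n+m ((w / m) ℕ.* m) k) (subst₂ _<_ w≡k+cm N≡em (n%ℕd<d (p′ ℤ.+ q′) N)))

      d : ℕ
      d = e ∸ w / m

      dm+w≡k+N : d ℕ.* m ℕ.+ w ≡ k ℕ.+ N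
      dm+w≡k+N = begin
        d ℕ.* m ℕ.+ w                           ≡⟨ cong (d ℕ.* m ℕ.+_) w≡k+cm ⟩
        d ℕ.* m ℕ.+ (k ℕ.+ (w / m) ℕ.* m)       ≡⟨ collect d m k (w / m) ⟩
        k ℕ.+ (w / m ℕ.+ d) ℕ.* m              ≡⟨ cong (λ x → k ℕ.+ x ℕ.* m) (ℕP.m+[n∸m]≡n (ℕP.<⇒≤ w/m<e)) ⟩
        k ℕ.+ e ℕ.* m                           ≡⟨ cong (k ℕ.+_) (sym N≡em) ⟩
        k ℕ.+ N                                 ∎
        where
        collect : ∀ d m k c → d ℕ.* m ℕ.+ (k ℕ.+ c ℕ.* m) ≡ k ℕ.+ (c ℕ.+ d) ℕ.* m
        collect = ℕSolver.solve-∀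

      shifted-sum : ∀ {q″} → q″ %ℕ N ≡ (+ (d ℕ.* m) ℤ.+ q′) %ℕ N → (p′ ℤ.+ q″) %ℕ N ≡ k
      shifted-sum {q″} q″≡ = begin
        (p′ ℤ.+ q″) %ℕ N                      ≡⟨ +-%ℕ-congʳ p′ q″ (+ (d ℕ.* m) ℤ.+ q′) N q″≡ ⟩
        (p′ ℤ.+ (+ (d ℕ.* m) ℤ.+ q′)) %ℕ N    ≡⟨ cong (_%ℕ N) (exchange p′ (+ (d ℕ.* m)) q′) ⟩
        (+ (d ℕ.* m) ℤ.+ (p′ ℤ.+ q′)) %ℕ N    ≡⟨ +-%ℕ-pos (d ℕ.* m) (p′ ℤ.+ q′) N ⟩
        (d ℕ.* m ℕ.+ w) % N                   ≡⟨ cong (_% N) dm+w≡k+N ⟩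
        (k ℕ.+ N) % N                         ≡⟨ [m+n]%n≡m%n k N ⟩
        k % N                                 ≡⟨ m<n⇒m%n≡m k<N ⟩
        k                                     ∎
        where
        exchange : ∀ x y z → x ℤ.+ (y ℤ.+ z) ≡ y ℤ.+ (x ℤ.+ z)
        exchange = solve-∀

      residue-preserved : ∀ {q″} → q″ %ℕ N ≡ (+ (d ℕ.* m) ℤ.+ q′) %ℕ N → q′ %ℕ m ≡ q″ %ℕ m
      residue-preserved {q″} q″≡ = begin
        q′ %ℕ m                                    ≡⟨ sym ([kd+x]%ℕd≡x%ℕd d q′ m) ⟩
        (+ (d ℕ.* m) ℤ.+ q′) %ℕ m                  ≡⟨ sym (%ℕ-%-divisor (+ (d ℕ.* m) ℤ.+ q′) N m m∣N) ⟩
        ((+ (d ℕ.* m) ℤ.+ q′) %ℕ N) % m            ≡⟨ cong (_% m) (sym q″≡) ⟩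
        (q″ %ℕ N) % m                              ≡⟨ %ℕ-%-divisor q″ N m m∣N ⟩
        q″ %ℕ m                                    ∎

-- Descent along a Hajós chain

inH-descent : ∀ {t m N Z Y P Q} .{{_ : NonZero N}} → 1 < t → InH t m Z Y →
              Factorization N P Q → Y ≐ cbcOf N P Q →
              Σ (NonZero m) λ nz →
                Factorization m {{nz}} P (ModSet Q m {{nz}}) × Z ≐ cbcOf m {{nz}} P (ModSet Q m {{nz}}) ×
                (IsHajos m P (ModSet Q m {{nz}}) → IsHajos N P Q)
inH-descent {t} {m} {N} {Z} {Y} {P} {Q} 1<t Y∈H@(Z-bounded , _ , k , _ , Y-def) fac Y≐X =
  m-nonZero , shiftClosed⇒factorization-mod closed m∣N fac , Z≐X ,
  stepQ fac m<N m∣N (shiftClosed⇒periodic closed m∣N)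
  where
  open ≡-Reasoning

  N≡mt : N ≡ m ℕ.* t
  N≡mt = inH-size Y∈H (hasSize-resp-≐ (≐-sym Y≐X) (cbcOf-size fac))

  instance
    m-nonZero : NonZero m
    m-nonZero = ℕ.≢-nonZero λ m≡0 → ℕ.≢-nonZero⁻¹ N (trans N≡mt (cong (ℕ._* t) m≡0))

  m<N : m < N
  m<N = subst (m <_) (sym N≡mt) (ℕP.m<m*n m t 1<t)

  N≡tm : N ≡ t ℕ.* m
  N≡tm = trans N≡mt (ℕP.*-comm m t)

  m∣N : m ∣ N
  m∣N = divides t N≡tm

  0<t : 0 < t
  0<t = ℕP.<-trans (s≤s z≤n) 1<t

  inY : ∀ {i j s} → Z (i , j) → s < t → cbcOf N P Q (i ℕ.+ k i j s ℕ.* m , j ℕ.+ s ℕ.* m)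
  inY z s<t = Equivalence.to (Y≐X _) (Equivalence.from (Y-def _ _) (_ , _ , _ , z , s<t , refl , refl))

  fromY : ∀ {u v} → cbcOf N P Q (u , v) → ∃ λ i → ∃ λ j → ∃ λ s → Z (i , j) × s < t ×
          u ≡ i ℕ.+ k i j s ℕ.* m × v ≡ j ℕ.+ s ℕ.* m
  fromY x = Equivalence.to (Y-def _ _) (Equivalence.from (Y≐X _) x)

  Q-residue : ∀ {q} → Q q → ∃ λ i → ∃ λ j → ∃ λ s → Z (i , j) × s < t × q %ℕ N ≡ j ℕ.+ s ℕ.* m
  Q-residue Qq =
    let (p₀ , _ , Pp₀ , _) = fac 0 (ℕ.>-nonZero⁻¹ N)
        (i , j , s , z , s<t , _ , q≡) = fromY (p₀ , _ , Pp₀ , Qq , refl , refl)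
    in i , j , s , z , s<t , q≡

  Q-attains : ∀ {i j s} → Z (i , j) → s < t → ∃ λ q → Q q × q %ℕ N ≡ j ℕ.+ s ℕ.* m
  Q-attains z s<t = let (_ , q , _ , Qq , _ , j+sm≡) = inY z s<t in q , Qq , sym j+sm≡

  shift-residue : ∀ {u j s} → u %ℕ N ≡ j ℕ.+ s ℕ.* m → (+ m ℤ.+ u) %ℕ N ≡ (j ℕ.+ suc s ℕ.* m) % N
  shift-residue {u} {j} {s} u≡ = begin
    (+ m ℤ.+ u) %ℕ N                ≡⟨ +-%ℕ-pos m u N ⟩
    (m ℕ.+ u %ℕ N) % N              ≡⟨ cong (λ x → (m ℕ.+ x) % N) u≡ ⟩
    (m ℕ.+ (j ℕ.+ s ℕ.* m)) % N     ≡⟨ cong (_% N) (rotate m j s) ⟩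
    (j ℕ.+ suc s ℕ.* m) % N         ∎
    where
    rotate : ∀ m j s → m ℕ.+ (j ℕ.+ s ℕ.* m) ≡ j ℕ.+ suc s ℕ.* m
    rotate = ℕSolver.solve-∀

  attains-next : ∀ {i j s} → Z (i , j) → s < t → ∃ λ q → Q q × q %ℕ N ≡ (j ℕ.+ suc s ℕ.* m) % N
  attains-next {i} {j} {s} z s<t with ℕP.m≤n⇒m<n∨m≡n s<t
  ... | inj₁ 1+s<t = let (q , Qq , q≡) = Q-attains z 1+s<t in q , Qq , trans (sym (%ℕ-%-idem q N)) (cong (_% N) q≡)
  -- level t wraps around to level 0, as t m = N
  ... | inj₂ 1+s≡t = let (q , Qq , q≡) = Q-attains {s = 0} z 0<t in q , Qq , (begin
    q %ℕ N                     ≡⟨ trans q≡ (ℕP.+-identityʳ j) ⟩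
    j                          ≡⟨ sym (m<n⇒m%n≡m (ℕP.<-trans (proj₂ (Z-bounded i j z)) m<N)) ⟩
    j % N                      ≡⟨ sym ([m+n]%n≡m%n j N) ⟩
    (j ℕ.+ N) % N              ≡⟨ cong (λ x → (j ℕ.+ x) % N) (trans N≡tm (cong (ℕ._* m) (sym 1+s≡t))) ⟩
    (j ℕ.+ suc s ℕ.* m) % N    ∎)

  closed : ShiftClosed N m Q
  closed {u} Qu =
    let (_ , j , s , z , s<t , u≡) = Q-residue Qu
        (q , Qq , q≡) = attains-next z s<t
    in q , Qq , trans q≡ (sym (shift-residue {u} {j} {s} u≡))

  Z≐X : Z ≐ cbcOf m P (ModSet Q m)
  Z≐X (i , j) = mk⇔ to from
    where
    to : Z (i , j) → cbcOf m P (ModSet Q m) (i , j)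
    to z =
      let (i<m , j<m) = Z-bounded i j z
          (p , q , Pp , Qq , i+km≡ , j+0m≡) = inY {s = 0} z 0<t
      in p , + (q %ℕ m) , Pp , (q , Qq , refl) ,
         sym (%ℕ-divisor-digit p (k i j 0) m∣N i<m (sym i+km≡)) ,
         sym (trans (%ℕ-%-idem q m) (%ℕ-divisor-digit q 0 m∣N j<m (sym j+0m≡)))

    from : cbcOf m P (ModSet Q m) (i , j) → Z (i , j)
    from (p , _ , Pp , (q , Qq , refl) , refl , refl) =
      let (i′ , j′ , s , z , _ , p≡ , q≡) = fromY (p , q , Pp , Qq , refl , refl)
          (i′<m , j′<m) = Z-bounded i′ j′ z
      in subst Z (sym (cong₂ _,_ (%ℕ-divisor-digit p (k i′ j′ s) m∣N i′<m p≡)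
                                 (trans (%ℕ-%-idem q m) (%ℕ-divisor-digit q s m∣N j′<m q≡)))) z

dual-resp-≐ : ∀ {X Y} → X ≐ Y → Dual X ≐ Dual Y
dual-resp-≐ X≐Y (i , j) = X≐Y (j , i)

dual-cbcOf : ∀ N .{{_ : NonZero N}} P Q → Dual (cbcOf N P Q) ≐ cbcOf N Q P
dual-cbcOf N P Q _ = mk⇔ (λ (p , q , Pp , Qq , i≡ , j≡) → q , p , Qq , Pp , j≡ , i≡)
                         (λ (q , p , Qq , Pp , i≡ , j≡) → p , q , Pp , Qq , j≡ , i≡)

chain-descent : ∀ {m Z ts Y N P Q} .{{_ : NonZero N}} → Chain m Z ts Y → All (1 <_) ts →
                Factorization N P Q → Y ≐ cbcOf N P Q →
                Σ (NonZero m) λ nz → Σ ZSet λ P′ → Σ ZSet λ Q′ →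
                  Factorization m {{nz}} P′ Q′ × Z ≐ cbcOf m {{nz}} P′ Q′ × (IsHajos m P′ Q′ → IsHajos N P Q)
chain-descent (last Y∈H) (1<t All.∷ All.[]) fac Y≐X =
  let (nz , fac′ , Z≐X′ , lift) = inH-descent 1<t Y∈H fac Y≐X in nz , _ , _ , fac′ , Z≐X′ , lift
chain-descent {m} (step {t = t} dualZ′∈H chain) (1<t All.∷ 1<ts) fac Y≐X =
  let (nz′ , P′ , Q′ , fac′ , Z′≐X′ , lift′) = chain-descent chain 1<ts fac Y≐X
      (nz , fac″ , Z≐X″ , lift) = inH-descent {{nz′}} 1<t dualZ′∈H (factorization-swap {{nz′}} fac′)
                                    (≐-trans (dual-resp-≐ Z′≐X′) (dual-cbcOf (m ℕ.* t) {{nz′}} P′ Q′))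
  in nz , _ , _ , fac″ , Z≐X″ , λ h → lift′ (isHajos-swap (lift h))

mainTheorem17 : (n : ℕ) .{{_ : NonZero n}} → NonHajosNumber n →
    Σ CbcFamily (λ E → Compatible n E × (IsHajosFamily n E → ⊥))
mainTheorem17 n (P , Q , fac , notHajos) = (_≐ cbcOf n P Q) , cbcOf-compatible fac , notOfHajos
  where
  notOfHajos : IsHajosFamily n (_≐ cbcOf n P Q) → ⊥
  notOfHajos (inj₁ (n≡1 , _)) = notHajos (hajos-of-size-1 n≡1 fac)
  notOfHajos (inj₂ (_ , _ , 1<ts , inj₁ chains)) =
    let (_ , _ , _ , fac₁ , _ , lift) = chain-descent (chains _ ≐-refl) 1<ts fac ≐-refl
    in notHajos (lift (base fac₁))
  notOfHajos (inj₂ (_ , _ , 1<ts , inj₂ chains)) =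
    let (_ , _ , _ , fac₁ , _ , lift) = chain-descent (chains _ ≐-refl) 1<ts (factorization-swap fac) (dual-cbcOf n P Q)
    in notHajos (isHajos-swap (lift (base fac₁)))
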